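{- Let $F$ be a forest, and let $X$ be a multiset of vertices of $F$. Then there is at most one linear forest that is a subgraph of $F$ with end-multiset equal to $X$.
   Context: A multiset is a set together with a positive integer (multiplicity) assigned to each member. A linear forest is a forest every component of which is a path. The end-multiset of a linear forest $H$ is the multiset of ends of the components of $H$, where an end of a component $P$ has multiplicity one if $P$ has at least one edge and multiplicity two if $P$ has no edges. -}

module Defs where

open import Data.Nat using (ℕ; _≤_)
open import Data.Fin using (Fin; _≟_)
open import Data.List using (List; []; _∷_; _++_; [_]; length; filter; concatMap)
open import Data.List.Relation.Unary.Any using (Any)
open import Data.List.Relation.Unary.Linked using (Linked)
open import Data.List.Relation.Unary.AllPairs using (AllPairs)
open import Data.List.Relation.Unary.Unique.Propositional using (Unique)
open import Data.List.Relation.Binary.Disjoint.Propositional using (Disjoint)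
open import Data.List.Membership.Propositional using (_∈_)
open import Data.Product using (Σ; _×_)
open import Data.Sum using (_⊎_)
open import Relation.Nullary using (¬_)
open import Relation.Binary.PropositionalEquality using (_≡_)
open import Function.Bundles using (_⇔_)
open import Level using (0ℓ)

record SimpleGraph (n : ℕ) : Set₁ where
  field
    Adj   : Fin n → Fin n → Set
    sym   : ∀ {u v} → Adj u v → Adj v u
    irrefl : ∀ {v} → ¬ Adj v v
open SimpleGraph public

lastOf : ∀ {n} → Fin n → List (Fin n) → Fin n
lastOf x [] = x
lastOf x (y ∷ ys) = lastOf y ys

IsCycle : ∀ {n} → SimpleGraph n → Fin n → List (Fin n) → Set
IsCycle G x xs = Unique (x ∷ xs) × (2 ≤ length xs) × Linked (Adj G) ((x ∷ xs) ++ [ x ])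

IsForest : ∀ {n} → SimpleGraph n → Set
IsForest G = ∀ x xs → ¬ IsCycle G x xs

-- A path in G (as a subgraph): a nonempty sequence of distinct vertices,
-- consecutive ones adjacent in G.  Its vertices are the listed ones and its
-- edges are the consecutive pairs.
record Path {n} (G : SimpleGraph n) : Set where
  constructor mkPath
  field
    start  : Fin n
    rest   : List (Fin n)
    unique : Unique (start ∷ rest)
    linked : Linked (Adj G) (start ∷ rest)
open Path public

pverts : ∀ {n} {G : SimpleGraph n} → Path G → List (Fin n)
pverts P = start P ∷ rest P

-- the two ends of a path (the same vertex twice if the path has no edges)
pends : ∀ {n} {G : SimpleGraph n} → Path G → List (Fin n)
pends P = start P ∷ lastOf (start P) (rest P) ∷ []

data Consec {n} (u v : Fin n) : List (Fin n) → Set where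
  here  : ∀ {xs} → Consec u v (u ∷ v ∷ xs)
  there : ∀ {x xs} → Consec u v xs → Consec u v (x ∷ xs)

PEdge : ∀ {n} {G : SimpleGraph n} → Path G → Fin n → Fin n → Set
PEdge P u v = Consec u v (pverts P) ⊎ Consec v u (pverts P)

-- A linear forest that is a subgraph of G, given by its components:
-- a list of pairwise vertex-disjoint paths in G.
record LinearSubforest {n} (G : SimpleGraph n) : Set where
  constructor mkLF
  field
    comps    : List (Path G)
    disjoint : AllPairs (λ P Q → Disjoint (pverts P) (pverts Q)) comps
open LinearSubforest public

LVert : ∀ {n} {G : SimpleGraph n} → LinearSubforest G → Fin n → Set
LVert H v = Any (λ P → v ∈ pverts P) (comps H)

LEdge : ∀ {n} {G : SimpleGraph n} → LinearSubforest G → Fin n → Fin n → Set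
LEdge H u v = Any (λ P → PEdge P u v) (comps H)

Multiset : ℕ → Set
Multiset n = Fin n → ℕ

count : ∀ {n} → Fin n → List (Fin n) → ℕ
count v xs = length (filter (_≟ v) xs)

endMultiset : ∀ {n} {G : SimpleGraph n} → LinearSubforest G → Multiset n
endMultiset H v = count v (concatMap pends (comps H))

SameSubgraph : ∀ {n} {G : SimpleGraph n} → LinearSubforest G → LinearSubforest G → Set
SameSubgraph H K = (∀ v → LVert H v ⇔ LVert K v) × (∀ u v → LEdge H u v ⇔ LEdge K u v)

{-# OPTIONS --safe #-}
module Submission where

-- Let H be a linear forest.  At a vertex v of H the degree of v in H and the
-- end multiplicity of v add up to 2; a vertex outside H has no H-edges and
-- multiplicity 0.  So if H and K have the same end-multiset, the H- and
-- K-neighbourhoods of every vertex have the same size, except that one of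
-- them may be empty while the other has two elements.  In either case no
-- vertex is incident to exactly one edge of the symmetric difference of the
-- edge sets.  A nonempty graph without vertices of degree one contains a
-- cycle, which cannot exist in the forest F: hence H and K have the same
-- edges.  They then have the same vertices, since a vertex of H is either
-- incident to an edge of H or is an isolated vertex of multiplicity 2.

open import Defs
open import Data.Nat using (ℕ; zero; suc; _+_; _≤_; s≤s; z≤n)
open import Data.Nat.Properties using (+-identityʳ; +-suc; <⇒≱; m≤n+m)
open import Data.Fin using (Fin; _≟_) renaming (zero to fzero; suc to fsuc)
open import Data.Fin.Properties using (injective⇒≤)
open import Data.List using (List; []; _∷_; _++_; [_]; length; filter; concatMap; lookup)
open import Data.List.Properties using (++-assoc; filter-++; length-++)
open import Data.List.Relation.Unary.Any as Any using (Any; here; there; any?)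
open import Data.List.Relation.Unary.Any.Properties using (∷↔)
open import Data.List.Relation.Unary.All as All using ([]; _∷_)
import Data.List.Relation.Unary.All.Properties as All
open import Data.List.Relation.Unary.Linked as Linked using (Linked; []; [-]; _∷_)
open import Data.List.Relation.Unary.AllPairs using (AllPairs; []; _∷_)
open import Data.List.Relation.Unary.Unique.Propositional using (Unique)
open import Data.List.Relation.Unary.Unique.Propositional.Properties using (Unique[x∷xs]⇒x∉xs)
open import Data.List.Relation.Binary.Disjoint.Propositional using (Disjoint)
open import Data.List.Membership.Propositional using (_∈_; _∉_)
open import Data.List.Membership.Propositional.Properties using (∈-lookup; ∈-∃++)
open import Data.Product as Product using (∃; ∃₂; _×_; _,_; proj₁; proj₂; swap)
open import Data.Sum as Sum using (_⊎_; inj₁; inj₂)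
open import Data.Empty using (⊥-elim)
open import Function using (_∘_; id)
open import Function.Bundles using (_⇔_; mk⇔; module Equivalence)
open import Function.Properties.Inverse using (↔⇒⇔)
open import Function.Construct.Symmetry using (⇔-sym)
open import Function.Construct.Composition using (_⇔-∘_)
open import Relation.Nullary using (¬_; Dec; yes; no)
open import Relation.Nullary.Decidable using (map′; _⊎-dec_)
open import Relation.Binary.PropositionalEquality as ≡ using (_≡_; _≢_; refl; trans; cong; subst)

open Equivalence using (to; from)

count-∷-≡ : ∀ {n} (v : Fin n) l → count v (v ∷ l) ≡ suc (count v l)
count-∷-≡ v l with v ≟ v
... | yes _ = refl
... | no v≢v = ⊥-elim (v≢v refl)

count-∷-≢ : ∀ {n} {x v : Fin n} l → x ≢ v → count v (x ∷ l) ≡ count v l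
count-∷-≢ {x = x} {v} l x≢v with x ≟ v
... | yes x≡v = ⊥-elim (x≢v x≡v)
... | no _ = refl

count-∉ : ∀ {n} {v : Fin n} xs → v ∉ xs → count v xs ≡ 0
count-∉ [] _ = refl
count-∉ (x ∷ xs) v∉ =
  trans (count-∷-≢ xs (λ x≡v → v∉ (here (≡.sym x≡v)))) (count-∉ xs (v∉ ∘ there))

count-++ : ∀ {n} (v : Fin n) xs ys → count v (xs ++ ys) ≡ count v xs + count v ys
count-++ v xs ys = trans (cong length (filter-++ (_≟ v) xs ys)) (length-++ (filter (_≟ v) xs))

Consec⇒∈ : ∀ {n} {u v : Fin n} {l} → Consec u v l → u ∈ l × v ∈ l
Consec⇒∈ here = here refl , there (here refl)
Consec⇒∈ (there c) = Product.map there there (Consec⇒∈ c)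

Linked-Consec : ∀ {n} {R : Fin n → Fin n → Set} {u v l} → Linked R l → Consec u v l → R u v
Linked-Consec (r ∷ _) here = r
Linked-Consec (_ ∷ l) (there c) = Linked-Consec l c

lastOf∈ : ∀ {n} (x : Fin n) xs → lastOf x xs ∈ x ∷ xs
lastOf∈ x [] = here refl
lastOf∈ x (y ∷ ys) = there (lastOf∈ y ys)

lastOf-∷ʳ : ∀ {n} (x : Fin n) s w → lastOf x (s ++ [ w ]) ≡ w
lastOf-∷ʳ x [] w = refl
lastOf-∷ʳ x (y ∷ s) w = lastOf-∷ʳ y s w

AllPairs-++⁻ˡ : ∀ {n} {R : Fin n → Fin n → Set} xs {ys} → AllPairs R (xs ++ ys) → AllPairs R xs
AllPairs-++⁻ˡ [] _ = []
AllPairs-++⁻ˡ (x ∷ xs) (px ∷ pxs) = All.++⁻ˡ xs px ∷ AllPairs-++⁻ˡ xs pxs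

Linked-++⁻ˡ : ∀ {n} {R : Fin n → Fin n → Set} xs {ys} → Linked R (xs ++ ys) → Linked R xs
Linked-++⁻ˡ [] _ = []
Linked-++⁻ˡ (x ∷ []) _ = [-]
Linked-++⁻ˡ (x ∷ y ∷ xs) (r ∷ l) = r ∷ Linked-++⁻ˡ (y ∷ xs) l

Linked-∷ʳ : ∀ {n} {R : Fin n → Fin n → Set} {x y : Fin n} xs
          → Linked R (x ∷ xs) → R (lastOf x xs) y → Linked R ((x ∷ xs) ++ [ y ])
Linked-∷ʳ [] _ r = r ∷ [-]
Linked-∷ʳ (z ∷ zs) (r ∷ l) r′ = r ∷ Linked-∷ʳ zs l r′

lookup-injective : ∀ {n} (l : List (Fin n)) → Unique l → ∀ {i j} → lookup l i ≡ lookup l j → i ≡ j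
lookup-injective (x ∷ l) uq {fzero} {fzero} _ = refl
lookup-injective (x ∷ l) (x∉ ∷ _) {fzero} {fsuc j} e = ⊥-elim (All.lookup x∉ (∈-lookup {xs = l} j) e)
lookup-injective (x ∷ l) (x∉ ∷ _) {fsuc i} {fzero} e = ⊥-elim (All.lookup x∉ (∈-lookup {xs = l} i) (≡.sym e))
lookup-injective (x ∷ l) (_ ∷ uq) {fsuc i} {fsuc j} e = cong fsuc (lookup-injective l uq e)

Unique⇒length≤ : ∀ {n} (l : List (Fin n)) → Unique l → length l ≤ n
Unique⇒length≤ l uq = injective⇒≤ (lookup-injective l uq)

-- Leafless graphs contain cycles

module _ {n} (F : SimpleGraph n) {D : Fin n → Fin n → Set}
         (D⇒Adj : ∀ {u v} → D u v → Adj F u v) (D-sym : ∀ {u v} → D u v → D v u)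
         (leafless : ∀ {v u} → D v u → ∃ λ w → w ≢ u × D v w) where

  private
    closeCycle : ∀ c p s w t → Unique (c ∷ p ∷ s ++ w ∷ t) → Linked D (c ∷ p ∷ s ++ w ∷ t) → D c w
               → ∃₂ λ x xs → IsCycle F x xs
    closeCycle c p s w t uq lk d =
      c , p ∷ s ++ [ w ] ,
      AllPairs-++⁻ˡ (c ∷ p ∷ s ++ [ w ]) (subst Unique split uq) ,
      2≤length s ,
      Linked.map D⇒Adj (Linked-∷ʳ (p ∷ s ++ [ w ])
        (Linked-++⁻ˡ (c ∷ p ∷ s ++ [ w ]) (subst (Linked D) split lk))
        (subst (λ z → D z c) (≡.sym (lastOf-∷ʳ p s w)) (D-sym d)))
      where
        split : c ∷ p ∷ s ++ w ∷ t ≡ (c ∷ p ∷ s ++ [ w ]) ++ t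
        split = ≡.sym (++-assoc (c ∷ p ∷ s) [ w ] t)
        2≤length : ∀ s → 2 ≤ length (p ∷ s ++ [ w ])
        2≤length [] = s≤s (s≤s z≤n)
        2≤length (_ ∷ _) = s≤s (s≤s z≤n)

    -- The walk c ∷ p ∷ r is stored backwards and never backtracks.  Its
    -- vertices are distinct, so there are at most n of them: with k steps of
    -- fuel to spare, some extension must revisit a vertex and close a cycle.
    walk : ∀ k c p r → Unique (c ∷ p ∷ r) → Linked D (c ∷ p ∷ r)
         → suc n ≤ length (c ∷ p ∷ r) + k → ∃₂ λ x xs → IsCycle F x xs
    walk zero c p r uq _ bound =
      ⊥-elim (<⇒≱ (subst (suc n ≤_) (+-identityʳ _) bound) (Unique⇒length≤ _ uq))
    walk (suc k) c p r uq (d ∷ lk) bound with leafless d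
    ... | w , w≢p , dcw with any? (w ≟_) (c ∷ p ∷ r)
    ...   | no w∉ = walk k w c (p ∷ r) (All.¬Any⇒All¬ _ w∉ ∷ uq) (D-sym dcw ∷ d ∷ lk)
                      (subst (suc n ≤_) (+-suc (length (c ∷ p ∷ r)) k) bound)
    ...   | yes (here w≡c) = ⊥-elim (irrefl F (subst (Adj F c) w≡c (D⇒Adj dcw)))
    ...   | yes (there (here w≡p)) = ⊥-elim (w≢p w≡p)
    ...   | yes (there (there w∈r)) with s , t , refl ← ∈-∃++ w∈r =
      closeCycle c p s w t uq (d ∷ lk) dcw

  leafless⇒cycle : ∀ {u v} → D u v → ∃₂ λ x xs → IsCycle F x xs
  leafless⇒cycle {u} {v} d = walk (suc n) u v [] ((u≢v ∷ []) ∷ [] ∷ []) (d ∷ [-]) (m≤n+m (suc n) 2)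
    where
      u≢v : u ≢ v
      u≢v refl = irrefl F (D⇒Adj d)

-- Neighbourhoods in a linear forest

-- N has exactly 2 − c elements: this is the neighbourhood of a vertex of a
-- linear forest at which c ends of its components sit.
data Nbhd {n} (N : Fin n → Set) : ℕ → Set where
  none : (∀ u → ¬ N u) → Nbhd N 2
  one  : ∀ a → (∀ u → N u ⇔ u ≡ a) → Nbhd N 1
  two  : ∀ a b → a ≢ b → (∀ u → N u ⇔ (u ≡ a ⊎ u ≡ b)) → Nbhd N 0

Nbhd-cong : ∀ {n} {N M : Fin n → Set} {c} → (∀ u → N u ⇔ M u) → Nbhd N c → Nbhd M c
Nbhd-cong N⇔M (none ¬N) = none (λ u → ¬N u ∘ from (N⇔M u))
Nbhd-cong N⇔M (one a N≡) = one a (λ u → N≡ u ⇔-∘ ⇔-sym (N⇔M u))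
Nbhd-cong N⇔M (two a b a≢b N≡) = two a b a≢b (λ u → N≡ u ⇔-∘ ⇔-sym (N⇔M u))

Nbhd-extend : ∀ {n} {N : Fin n → Set} {c} → Nbhd N (suc c) → ∀ x → ¬ N x → Nbhd (λ u → N u ⊎ u ≡ x) c
Nbhd-extend (none ¬N) x _ = one x (λ u → mk⇔ Sum.[ ⊥-elim ∘ ¬N u , id ] inj₂)
Nbhd-extend {N = N} (one a N≡) x ¬Nx =
  two a x (λ a≡x → ¬Nx (subst N a≡x (from (N≡ a) refl))) (λ u → mk⇔ (Sum.map₁ (to (N≡ u))) (Sum.map₁ (from (N≡ u))))

Nbhd-dec : ∀ {n} {N : Fin n → Set} {c} → Nbhd N c → ∀ w → Dec (N w)
Nbhd-dec (none ¬N) w = no (¬N w)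
Nbhd-dec (one a N≡) w = map′ (from (N≡ w)) (to (N≡ w)) (w ≟ a)
Nbhd-dec (two a b _ N≡) w = map′ (from (N≡ w)) (to (N≡ w)) ((w ≟ a) ⊎-dec (w ≟ b))

two-other : ∀ {n} {N : Fin n → Set} {a b u : Fin n} → a ≢ b → (∀ w → N w ⇔ (w ≡ a ⊎ w ≡ b)) → N u
          → ∃ λ o → o ≢ u × N o × (∀ w → N w → w ≡ u ⊎ w ≡ o)
two-other {a = a} {b} {u} a≢b N≡ Nu with to (N≡ u) Nu
... | inj₁ refl = b , a≢b ∘ ≡.sym , from (N≡ b) (inj₂ refl) , to ∘ N≡
... | inj₂ refl = a , a≢b , from (N≡ a) (inj₁ refl) , λ w → Sum.swap ∘ to (N≡ w)

Neighbours : ∀ {n} → List (Fin n) → Fin n → Fin n → Set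
Neighbours L v u = Consec v u L ⊎ Consec u v L

Neighbours-[] : ∀ {n} {x v u : Fin n} → ¬ Neighbours (x ∷ []) v u
Neighbours-[] (inj₁ (there ()))
Neighbours-[] (inj₂ (there ()))

Neighbours-sym : ∀ {n} {L} {v u : Fin n} → Neighbours L v u → Neighbours L u v
Neighbours-sym = Sum.swap

Neighbours⇒∈ : ∀ {n} {L} {v u : Fin n} → Neighbours L v u → v ∈ L
Neighbours⇒∈ (inj₁ c) = proj₁ (Consec⇒∈ c)
Neighbours⇒∈ (inj₂ c) = proj₂ (Consec⇒∈ c)

Neighbours-head : ∀ {n} {x y u : Fin n} {ys} → Unique (x ∷ y ∷ ys) → Neighbours (x ∷ y ∷ ys) x u ⇔ u ≡ y
Neighbours-head {x = x} {y} {u} {ys} uq = mk⇔ head⇒ λ { refl → inj₁ here }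
  where
    x∉ : x ∉ y ∷ ys
    x∉ = Unique[x∷xs]⇒x∉xs uq
    head⇒ : Neighbours (x ∷ y ∷ ys) x u → u ≡ y
    head⇒ (inj₁ here) = refl
    head⇒ (inj₁ (there c)) = ⊥-elim (x∉ (proj₁ (Consec⇒∈ c)))
    head⇒ (inj₂ here) = ⊥-elim (x∉ (here refl))
    head⇒ (inj₂ (there c)) = ⊥-elim (x∉ (proj₂ (Consec⇒∈ c)))

Neighbours-second : ∀ {n} {x y u : Fin n} {ys} → x ≢ y
                  → Neighbours (x ∷ y ∷ ys) y u ⇔ (Neighbours (y ∷ ys) y u ⊎ u ≡ x)
Neighbours-second {x = x} {y} {u} {ys} x≢y = mk⇔ second⇒ second⇐
  where
    second⇒ : Neighbours (x ∷ y ∷ ys) y u → Neighbours (y ∷ ys) y u ⊎ u ≡ x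
    second⇒ (inj₁ here) = ⊥-elim (x≢y refl)
    second⇒ (inj₁ (there c)) = inj₁ (inj₁ c)
    second⇒ (inj₂ here) = inj₂ refl
    second⇒ (inj₂ (there c)) = inj₁ (inj₂ c)
    second⇐ : Neighbours (y ∷ ys) y u ⊎ u ≡ x → Neighbours (x ∷ y ∷ ys) y u
    second⇐ (inj₁ (inj₁ c)) = inj₁ (there c)
    second⇐ (inj₁ (inj₂ c)) = inj₂ (there c)
    second⇐ (inj₂ refl) = inj₂ here

Neighbours-∷ : ∀ {n} {x y v u : Fin n} {ys} → x ≢ v → y ≢ v
             → Neighbours (x ∷ y ∷ ys) v u ⇔ Neighbours (y ∷ ys) v u
Neighbours-∷ {x = x} {y} {v} {u} {ys} x≢v y≢v = mk⇔ tail⇒ (Sum.map there there)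
  where
    tail⇒ : Neighbours (x ∷ y ∷ ys) v u → Neighbours (y ∷ ys) v u
    tail⇒ (inj₁ here) = ⊥-elim (x≢v refl)
    tail⇒ (inj₁ (there c)) = inj₁ c
    tail⇒ (inj₂ here) = ⊥-elim (y≢v refl)
    tail⇒ (inj₂ (there c)) = inj₂ c

pathNbhd : ∀ {n} (x : Fin n) xs {v} → Unique (x ∷ xs) → v ∈ x ∷ xs
         → Nbhd (Neighbours (x ∷ xs) v) (count v (x ∷ lastOf x xs ∷ []))
pathNbhd x [] _ (here refl) = subst (Nbhd _) (≡.sym ends) (none λ _ → Neighbours-[])
  where
    ends : count x (x ∷ x ∷ []) ≡ 2
    ends = trans (count-∷-≡ x (x ∷ [])) (cong suc (count-∷-≡ x []))
pathNbhd x (y ∷ ys) uq (here refl) = subst (Nbhd _) (≡.sym ends) (one y λ _ → Neighbours-head uq)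
  where
    last≢x : lastOf y ys ≢ x
    last≢x last≡x = Unique[x∷xs]⇒x∉xs uq (subst (_∈ y ∷ ys) last≡x (lastOf∈ y ys))
    ends : count x (x ∷ lastOf y ys ∷ []) ≡ 1
    ends = trans (count-∷-≡ x (lastOf y ys ∷ [])) (cong suc (count-∷-≢ [] last≢x))
pathNbhd x (y ∷ ys) uq@(x∉ ∷ uq′) (there (here refl)) =
  subst (Nbhd _) (≡.sym (count-∷-≢ (lastOf y ys ∷ []) x≢y))
    (Nbhd-cong (λ _ → ⇔-sym (Neighbours-second x≢y))
      (Nbhd-extend (subst (Nbhd _) (count-∷-≡ y (lastOf y ys ∷ [])) (pathNbhd y ys uq′ (here refl))) x
        (Unique[x∷xs]⇒x∉xs uq ∘ Neighbours⇒∈ ∘ Neighbours-sym)))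
  where
    x≢y : x ≢ y
    x≢y = All.head x∉
pathNbhd x (y ∷ ys) {v} uq@(_ ∷ uq′) (there (there v∈ys)) =
  subst (Nbhd _) (trans (count-∷-≢ (lastOf y ys ∷ []) y≢v) (≡.sym (count-∷-≢ (lastOf y ys ∷ []) x≢v)))
    (Nbhd-cong (λ _ → ⇔-sym (Neighbours-∷ x≢v y≢v)) (pathNbhd y ys uq′ (there v∈ys)))
  where
    x≢v : x ≢ v
    x≢v x≡v = Unique[x∷xs]⇒x∉xs uq (there (subst (_∈ ys) (≡.sym x≡v) v∈ys))
    y≢v : y ≢ v
    y≢v y≡v = Unique[x∷xs]⇒x∉xs uq′ (subst (_∈ ys) (≡.sym y≡v) v∈ys)

data LocalView {n} (V : Set) (N : Fin n → Set) : ℕ → Set where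
  absent  : ¬ V → (∀ u → ¬ N u) → LocalView V N 0
  present : ∀ {c} → V → Nbhd N c → LocalView V N c

LocalView-cong : ∀ {n} {V W : Set} {N M : Fin n → Set} {c d}
               → V ⇔ W → (∀ u → N u ⇔ M u) → c ≡ d → LocalView V N c → LocalView W M d
LocalView-cong V⇔W N⇔M refl (absent ¬V ¬N) = absent (¬V ∘ from V⇔W) (λ u → ¬N u ∘ from (N⇔M u))
LocalView-cong V⇔W N⇔M refl (present v nbhd) = present (to V⇔W v) (Nbhd-cong N⇔M nbhd)

LocalView-⊎ : ∀ {n} {V W : Set} {N M : Fin n → Set} {c d} → ¬ (V × W)
            → LocalView V N c → LocalView W M d → LocalView (V ⊎ W) (λ u → N u ⊎ M u) (c + d)
LocalView-⊎ _ (absent ¬V ¬N) (absent ¬W ¬M) =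
  absent Sum.[ ¬V , ¬W ] (λ u → Sum.[ ¬N u , ¬M u ])
LocalView-⊎ _ (absent _ ¬N) (present w nbhd) =
  present (inj₂ w) (Nbhd-cong (λ u → mk⇔ inj₂ Sum.[ ⊥-elim ∘ ¬N u , id ]) nbhd)
LocalView-⊎ _ (present v nbhd) (absent _ ¬M) =
  subst (LocalView _ _) (≡.sym (+-identityʳ _))
    (present (inj₁ v) (Nbhd-cong (λ u → mk⇔ inj₁ Sum.[ id , ⊥-elim ∘ ¬M u ]) nbhd))
LocalView-⊎ V×W↯ (present v _) (present w _) = ⊥-elim (V×W↯ (v , w))

module _ {n} {F : SimpleGraph n} where

  pends⊆pverts : ∀ (P : Path F) {v} → v ∈ pends P → v ∈ pverts P
  pends⊆pverts P (here refl) = here refl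
  pends⊆pverts P (there (here refl)) = lastOf∈ (start P) (rest P)

  pathView : (P : Path F) (v : Fin n) → LocalView (v ∈ pverts P) (PEdge P v) (count v (pends P))
  pathView P v with any? (v ≟_) (pverts P)
  ... | yes v∈P = present v∈P (pathNbhd (start P) (rest P) (unique P) v∈P)
  ... | no v∉P =
    subst (LocalView _ _) (≡.sym (count-∉ (pends P) (v∉P ∘ pends⊆pverts P))) (absent v∉P (λ _ → v∉P ∘ Neighbours⇒∈))

  pathsView : (ps : List (Path F)) → AllPairs (λ P Q → Disjoint (pverts P) (pverts Q)) ps → (v : Fin n)
            → LocalView (Any (λ P → v ∈ pverts P) ps) (λ u → Any (λ P → PEdge P v u) ps) (count v (concatMap pends ps))
  pathsView [] _ v = absent (λ ()) (λ _ ())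
  pathsView (P ∷ ps) (P#ps ∷ ps#) v =
    LocalView-cong (↔⇒⇔ (∷↔ _)) (λ _ → ↔⇒⇔ (∷↔ _)) (≡.sym (count-++ v (pends P) (concatMap pends ps)))
      (LocalView-⊎ (λ (v∈P , v∈ps) → let P#Q , v∈Q = All.lookupAny P#ps v∈ps in P#Q (v∈P , v∈Q))
        (pathView P v) (pathsView ps ps# v))

  localView : (H : LinearSubforest F) (v : Fin n) → LocalView (LVert H v) (LEdge H v) (endMultiset H v)
  localView H = pathsView (comps H) (disjoint H)

  PEdge⇒Adj : ∀ (P : Path F) {u v} → PEdge P u v → Adj F u v
  PEdge⇒Adj P (inj₁ c) = Linked-Consec (linked P) c
  PEdge⇒Adj P (inj₂ c) = SimpleGraph.sym F (Linked-Consec (linked P) c)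

  LEdge-sym : ∀ (H : LinearSubforest F) {u v} → LEdge H u v → LEdge H v u
  LEdge-sym H = Any.map Neighbours-sym

  LEdge⇒Adj : ∀ (H : LinearSubforest F) {u v} → LEdge H u v → Adj F u v
  LEdge⇒Adj H e = let P , uv∈P = Any.satisfied e in PEdge⇒Adj P uv∈P

-- Comparing two linear forests with the same end-multiset

SymDiff : ∀ {n} → (Fin n → Set) → (Fin n → Set) → Fin n → Set
SymDiff N M w = (N w × ¬ M w) ⊎ (¬ N w × M w)

SymDiff-comm : ∀ {n} {N M : Fin n → Set} {w} → SymDiff N M w → SymDiff M N w
SymDiff-comm = Sum.map swap swap ∘ Sum.swap

¬SymDiff⇒⇔ : ∀ {n} {N M : Fin n → Set} {w} → Dec (N w) → Dec (M w) → ¬ SymDiff N M w → N w ⇔ M w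
¬SymDiff⇒⇔ N? M? ¬Δ = mk⇔ (only N? M? (¬Δ ∘ inj₁)) (only M? N? (¬Δ ∘ inj₂ ∘ swap))
  where
    only : ∀ {A B : Set} → Dec A → Dec B → ¬ (A × ¬ B) → A → B
    only _ (yes b) _ _ = b
    only _ (no ¬b) ¬A×¬B a = ⊥-elim (¬A×¬B (a , ¬b))

LocalView-dec : ∀ {n} {V : Set} {N : Fin n → Set} {c} → LocalView V N c → ∀ w → Dec (N w)
LocalView-dec (absent _ ¬N) w = no (¬N w)
LocalView-dec (present _ nbhd) w = Nbhd-dec nbhd w

SymDiff-leaflessˡ : ∀ {n} {VH VK : Set} {NH NK : Fin n → Set} {c} → LocalView VH NH c → LocalView VK NK c
                  → ∀ {u} → NH u → ¬ NK u → ∃ λ w → w ≢ u × SymDiff NH NK w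
SymDiff-leaflessˡ (absent _ ¬NH) _ NHu _ = ⊥-elim (¬NH _ NHu)
SymDiff-leaflessˡ (present _ (none ¬NH)) _ NHu _ = ⊥-elim (¬NH _ NHu)
SymDiff-leaflessˡ (present _ (one a NH≡)) (present _ (one b NK≡)) {u} NHu ¬NKu =
  b , b≢u , inj₂ ((λ NHb → b≢u (trans (to (NH≡ b) NHb) (≡.sym (to (NH≡ u) NHu)))) , from (NK≡ b) refl)
  where
    b≢u : b ≢ u
    b≢u b≡u = ¬NKu (from (NK≡ u) (≡.sym b≡u))
SymDiff-leaflessˡ (present _ (two a b a≢b NH≡)) (absent _ ¬NK) NHu _
  with o , o≢u , NHo , _ ← two-other a≢b NH≡ NHu = o , o≢u , inj₁ (NHo , ¬NK o)
SymDiff-leaflessˡ (present _ (two a b a≢b NH≡)) (present _ (two c d c≢d NK≡)) {u} NHu ¬NKu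
  with o , o≢u , NHo , NH⊆uo ← two-other a≢b NH≡ NHu | Nbhd-dec (two c d c≢d NK≡) o
... | no ¬NKo = o , o≢u , inj₁ (NHo , ¬NKo)
... | yes NKo with o′ , o′≢o , NKo′ , _ ← two-other c≢d NK≡ NKo =
  o′ , o′≢u , inj₂ (Sum.[ o′≢u , o′≢o ] ∘ NH⊆uo o′ , NKo′)
  where
    o′≢u : o′ ≢ u
    o′≢u refl = ¬NKu NKo′

SymDiff-leafless : ∀ {n} {VH VK : Set} {NH NK : Fin n → Set} {c} → LocalView VH NH c → LocalView VK NK c
                 → ∀ {u} → SymDiff NH NK u → ∃ λ w → w ≢ u × SymDiff NH NK w
SymDiff-leafless viewH viewK (inj₁ (NHu , ¬NKu)) = SymDiff-leaflessˡ viewH viewK NHu ¬NKu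
SymDiff-leafless {NH = NH} {NK} viewH viewK (inj₂ (¬NHu , NKu))
  with w , w≢u , Δ ← SymDiff-leaflessˡ viewK viewH NKu ¬NHu = w , w≢u , SymDiff-comm {N = NK} {NH} Δ

present⇒present : ∀ {n} {VH VK : Set} {NH NK : Fin n → Set} {c}
                → LocalView VH NH c → LocalView VK NK c → (∀ u → NH u → NK u) → VH → VK
present⇒present (absent ¬VH _) _ _ vH = ⊥-elim (¬VH vH)
present⇒present (present _ _) (present vK _) _ _ = vK
present⇒present (present _ (two a _ _ NH≡)) (absent _ ¬NK) NH⊆NK _ =
  ⊥-elim (¬NK a (NH⊆NK a (from (NH≡ a) (inj₁ refl))))

mainTheorem17 : ∀ {n} (F : SimpleGraph n) → IsForest F → (X : Multiset n)
    → (H K : LinearSubforest F)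
    → (∀ v → endMultiset H v ≡ X v) → (∀ v → endMultiset K v ≡ X v)
    → SameSubgraph H K
mainTheorem17 {n} F forest X H K endsH endsK = sameVertices , sameEdges
  where
    viewH : ∀ v → LocalView (LVert H v) (LEdge H v) (X v)
    viewH v = subst (LocalView _ _) (endsH v) (localView H v)
    viewK : ∀ v → LocalView (LVert K v) (LEdge K v) (X v)
    viewK v = subst (LocalView _ _) (endsK v) (localView K v)

    Δ : Fin n → Fin n → Set
    Δ u = SymDiff (LEdge H u) (LEdge K u)

    Δ⇒Adj : ∀ {u v} → Δ u v → Adj F u v
    Δ⇒Adj = Sum.[ LEdge⇒Adj H ∘ proj₁ , LEdge⇒Adj K ∘ proj₂ ]

    Δ-sym : ∀ {u v} → Δ u v → Δ v u
    Δ-sym = Sum.map (Product.map (LEdge-sym H) (_∘ LEdge-sym K)) (Product.map (_∘ LEdge-sym H) (LEdge-sym K))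

    Δ-empty : ∀ {u v} → ¬ Δ u v
    Δ-empty δ with x , xs , cycle ← leafless⇒cycle F Δ⇒Adj Δ-sym (λ {v} → SymDiff-leafless (viewH v) (viewK v)) δ =
      forest x xs cycle

    sameEdges : ∀ u v → LEdge H u v ⇔ LEdge K u v
    sameEdges u v = ¬SymDiff⇒⇔ {N = LEdge H u} {LEdge K u} (LocalView-dec (viewH u) v) (LocalView-dec (viewK u) v) Δ-empty

    sameVertices : ∀ v → LVert H v ⇔ LVert K v
    sameVertices v = mk⇔ (present⇒present (viewH v) (viewK v) (λ u → to (sameEdges v u)))
                         (present⇒present (viewK v) (viewH v) (λ u → from (sameEdges v u)))
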